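{- Let $d\ge1$, let $S_1,\ldots,S_d$ be numerical semigroups different from $\mathbb{N}$, and let $S=\mathbb{N}^d\setminus\bigcup_{i=1}^d\{h\mathbf{e}_i:h\in\operatorname{H}(S_i)\}$. Suppose that each $S_i$ satisfies Wilf's conjecture, i.e. $\operatorname{e}(S_i)\operatorname{n}(S_i)\ge\operatorname{c}(S_i)$ for all $i\in\{1,\ldots,d\}$. Then $S$ satisfies the generalized Wilf's conjecture, i.e. $\operatorname{e}(S)\operatorname{n}(S)\ge d\operatorname{c}(S)$.
   Context: $\mathbb{N}$ is the set of non-negative integers; $\mathbf{e}_i$ are standard basis vectors; $\le$ is the componentwise order on $\mathbb{N}^d$. For a GNS $S\subseteq\mathbb{N}^d$ (submonoid with finite complement $\operatorname{H}(S)$; numerical semigroup when $d=1$): $\operatorname{e}(S)$ is the cardinality of its minimal system of generators; $\operatorname{n}(S)=|\{\mathbf{s}\in S:\mathbf{s}\le\mathbf{h}\text{ for some }\mathbf{h}\in\operatorname{H}(S)\}|$; $\operatorname{c}(S)=|\{\mathbf{x}\in\mathbb{N}^d:\mathbf{x}\le\mathbf{h}\text{ for some }\mathbf{h}\in\operatorname{H}(S)\}|$. -}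

module Defs where

open import Level using (0ℓ)
open import Data.Nat using (ℕ; zero; suc; _+_; _*_; _≤_)
open import Data.Bool using (Bool; true; false)
open import Data.Fin using (Fin)
open import Data.Vec using (Vec; replicate; zipWith; _[_]≔_)
open import Data.Vec.Relation.Binary.Pointwise.Inductive using (Pointwise)
open import Data.List using (List; length)
open import Data.List.Membership.Propositional using (_∈_)
open import Data.List.Relation.Unary.Unique.Propositional using (Unique)
open import Data.Product using (Σ; _×_; ∃)
open import Relation.Binary.PropositionalEquality using (_≡_; _≢_)
open import Relation.Nullary using (¬_)
open import Function.Bundles using (_⇔_)

HasCard : {A : Set} → (A → Set) → ℕ → Set
HasCard {A} P k =
  Σ (List A) λ xs → Unique xs × (∀ x → (x ∈ xs) ⇔ P x) × length xs ≡ k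

module Invariants {A : Set} (𝟘 : A) (_⊕_ : A → A → A) (_≼_ : A → A → Set)
                  (P : A → Set) where

  Gap : A → Set
  Gap x = ¬ P x

  MinGen : A → Set
  MinGen x = P x × x ≢ 𝟘 ×
    ¬ (Σ A λ y → Σ A λ z → P y × P z × y ≢ 𝟘 × z ≢ 𝟘 × x ≡ y ⊕ z)

  NSet : A → Set
  NSet x = P x × (Σ A λ h → Gap h × x ≼ h)

  CSet : A → Set
  CSet x = Σ A λ h → Gap h × x ≼ h

  IsE IsN IsC : ℕ → Set
  IsE = HasCard MinGen
  IsN = HasCard NSet
  IsC = HasCard CSet

InNS : (ℕ → Bool) → ℕ → Set
InNS T x = T x ≡ true

record IsNumericalSemigroup (T : ℕ → Bool) : Set where
  field
    has-zero   : T 0 ≡ true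
    closed-add : ∀ a b → T a ≡ true → T b ≡ true → T (a + b) ≡ true
    cofinite   : ∃ λ f → ∀ x → f ≤ x → T x ≡ true

module NSInv (T : ℕ → Bool) = Invariants 0 _+_ _≤_ (InNS T)

WilfNS : (ℕ → Bool) → Set
WilfNS T = ∀ e n c → NSInv.IsE T e → NSInv.IsN T n → NSInv.IsC T c → c ≤ e * n

Vℕ : ℕ → Set
Vℕ d = Vec ℕ d

𝟎 : ∀ d → Vℕ d
𝟎 d = replicate d 0

_⊕_ : ∀ {d} → Vℕ d → Vℕ d → Vℕ d
_⊕_ = zipWith _+_

_≤ᵥ_ : ∀ {d} → Vℕ d → Vℕ d → Set
_≤ᵥ_ = Pointwise _≤_

scaledUnit : ∀ d → Fin d → ℕ → Vℕ d
scaledUnit d i h = replicate d 0 [ i ]≔ h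

GluedS : ∀ d → (Fin d → ℕ → Bool) → Vℕ d → Set
GluedS d T x = ¬ (Σ (Fin d) λ i → Σ ℕ λ h → T i h ≡ false × x ≡ scaledUnit d i h)

module GNSInv (d : ℕ) (P : Vℕ d → Set) = Invariants (𝟎 d) _⊕_ _≤ᵥ_ P

GenWilf : ∀ d → (Vℕ d → Set) → Set
GenWilf d P = ∀ e n c → GNSInv.IsE d P e → GNSInv.IsN d P n → GNSInv.IsC d P c →
  d * c ≤ e * n

{-# OPTIONS --safe #-}
-- The gaps of S are exactly the points h eᵢ with h a gap of Sᵢ. Hence, writing Fᵢ, mᵢ for
-- the Frobenius number and the multiplicity of Sᵢ, we get c(S) = 1 + Σ Fᵢ and
-- n(S) = 1 + Σ (n(Sᵢ) − 1), while the minimal generators of S include those of every Sᵢ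
-- placed on the i-th axis together with the (d − 1)(mᵢ − 1) vectors a eᵢ + eⱼ (j ≠ i,
-- 2 ≤ a ≤ mᵢ). Adding up, over i, Wilf's inequality c(Sᵢ) ≤ e(Sᵢ) n(Sᵢ) and (d − 1) times
-- the elementary bound c(Sᵢ) ≤ n(Sᵢ) mᵢ then yields d c(S) ≤ e(S) n(S).
module Submission where

open import Data.Bool using (Bool; true; false)
import Data.Bool as Bool
open import Data.Bool.Properties using (¬-not; not-¬)
open import Data.Empty using (⊥; ⊥-elim)
open import Data.Fin using (Fin; punchIn) renaming (zero to fzero; suc to fsuc)
import Data.Fin as Fin
import Data.Fin.Properties as Finₚ
open import Data.Fin.Properties using (punchInᵢ≢i; punchIn-injective)
open import Data.List using (List; []; _∷_; _++_; length; map; applyUpTo; concatMap; upTo; filter)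
open import Data.List.Properties using (length-++; length-applyUpTo; length-upTo; length-map)
open import Data.List.Membership.Propositional using (_∈_)
open import Data.List.Membership.Propositional.Properties
  using (∈-∃++; ∈-++⁺ˡ; ∈-++⁺ʳ; ∈-++⁻; ∈-applyUpTo⁺; ∈-applyUpTo⁻; ∈-upTo⁺; ∈-upTo⁻;
         ∈-filter⁺; ∈-filter⁻; ∈-concat⁺′; ∈-map⁺; ∈-map⁻)
open import Data.List.Relation.Binary.Subset.Propositional using (_⊆_)
open import Data.List.Relation.Unary.Any using (here; there)
open import Data.List.Relation.Unary.All as All using (All; _∷_)
open import Data.List.Relation.Unary.Unique.Propositional using (Unique; []; _∷_)
open import Data.List.Relation.Unary.Unique.Propositional.Properties
  using (++⁺; map⁺; applyUpTo⁺₁; upTo⁺; filter⁺)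
open import Data.Nat using (ℕ; zero; suc; _+_; _*_; _∸_; _≤_; _<_; z≤n; s≤s; s≤s⁻¹)
open import Data.Nat.Induction using (<-rec)
open import Data.Nat.Properties
open import Algebra.Properties.Semiring.Sum +-*-semiring
  using (sum; sum-syntax; ∑-distrib-+; *-distribˡ-sum; *-distribʳ-sum; sum-cong-≗)
open import Data.Nat.Tactic.RingSolver using (solve-∀)
open import Data.Product using (Σ; ∃; _×_; _,_; proj₁; proj₂)
open import Data.Sum using (inj₁; inj₂)
open import Data.Vec using (Vec; []; _∷_; lookup)
open import Data.Vec.Properties using (≡-dec; lookup∘update; lookup∘update′; lookup-zipWith; lookup-replicate)
open import Data.Vec.Relation.Binary.Pointwise.Inductive as Pointwise using (Pointwise; []; _∷_; Pointwise-≡⇒≡)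
open import Function using (_∘_; case_of_)
open import Function.Bundles using (mk⇔; Equivalence)
open import Relation.Binary.PropositionalEquality
open import Relation.Nullary using (¬_; Dec; yes; no; ¬?)
open import Relation.Nullary.Decidable using (_×-dec_; map′; decidable-stable)
open import Relation.Unary using (Pred; Decidable)

open import Defs

module _ {A : Set} where

  ∈-++-drop : ∀ {x y : A} xs ys → y ∈ xs ++ x ∷ ys → y ≢ x → y ∈ xs ++ ys
  ∈-++-drop []       ys (here refl) y≢x = ⊥-elim (y≢x refl)
  ∈-++-drop []       ys (there p)   y≢x = p
  ∈-++-drop (_ ∷ xs) ys (here refl) y≢x = here refl
  ∈-++-drop (_ ∷ xs) ys (there p)   y≢x = there (∈-++-drop xs ys p y≢x)

  Unique⇒length≤ : ∀ {xs ys : List A} → Unique xs → xs ⊆ ys → length xs ≤ length ys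
  Unique⇒length≤ {[]}     []         _   = z≤n
  Unique⇒length≤ {x ∷ xs} (x∉ ∷ uxs) xs⊆ with ∈-∃++ (xs⊆ (here refl))
  ... | ys₁ , ys₂ , refl = begin
    suc (length xs)               ≤⟨ s≤s (Unique⇒length≤ uxs xs⊆ys₁ys₂) ⟩
    suc (length (ys₁ ++ ys₂))     ≡⟨ cong suc (length-++ ys₁) ⟩
    suc (length ys₁ + length ys₂) ≡⟨ +-suc (length ys₁) _ ⟨
    length ys₁ + length (x ∷ ys₂) ≡⟨ length-++ ys₁ ⟨
    length (ys₁ ++ x ∷ ys₂)       ∎
    where
    open ≤-Reasoning
    xs⊆ys₁ys₂ : xs ⊆ ys₁ ++ ys₂
    xs⊆ys₁ys₂ y∈xs = ∈-++-drop ys₁ ys₂ (xs⊆ (there y∈xs)) (λ y≡x → All.lookup x∉ y∈xs (sym y≡x))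

  HasCard⇒≤length : ∀ {P : A → Set} {k} {ys : List A} →
    HasCard P k → (∀ {x} → P x → x ∈ ys) → k ≤ length ys
  HasCard⇒≤length (xs , uxs , xs⇔P , refl) P⊆ys =
    Unique⇒length≤ uxs (λ {x} x∈xs → P⊆ys (Equivalence.to (xs⇔P x) x∈xs))

  HasCard⇒length≤ : ∀ {P : A → Set} {k} {ys : List A} →
    HasCard P k → Unique ys → (∀ {x} → x ∈ ys → P x) → length ys ≤ k
  HasCard⇒length≤ (xs , _ , xs⇔P , refl) uys ys⊆P =
    Unique⇒length≤ uys (λ {x} x∈ys → Equivalence.from (xs⇔P x) (ys⊆P x∈ys))

length-concatMap-const : ∀ {A B : Set} (f : A → List B) {k} → (∀ x → length (f x) ≡ k) →
  ∀ xs → length (concatMap f xs) ≡ length xs * k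
length-concatMap-const f ∣f∣≡k []       = refl
length-concatMap-const f ∣f∣≡k (x ∷ xs) =
  trans (length-++ (f x)) (cong₂ _+_ (∣f∣≡k x) (length-concatMap-const f ∣f∣≡k xs))

range : ℕ → ℕ → List ℕ
range a k = applyUpTo (a +_) k

length-range : ∀ a k → length (range a k) ≡ k
length-range a k = length-applyUpTo (a +_) k

range-unique : ∀ a k → Unique (range a k)
range-unique a k = applyUpTo⁺₁ (a +_) k (λ i<j _ → <⇒≢ i<j ∘ +-cancelˡ-≡ a _ _)

∈-range⁺ : ∀ {a k x} → a ≤ x → x < a + k → x ∈ range a k
∈-range⁺ {a} {k} {x} a≤x x<a+k = subst (_∈ range a k) (m+[n∸m]≡n a≤x)
  (∈-applyUpTo⁺ (a +_) (+-cancelˡ-< a _ _ (subst (_< a + k) (sym (m+[n∸m]≡n a≤x)) x<a+k)))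

∈-range⁻ : ∀ {a k x} → x ∈ range a k → a ≤ x × x < a + k
∈-range⁻ {a} x∈ with ∈-applyUpTo⁻ (a +_) x∈
... | i , i<k , refl = m≤m+n a i , +-monoʳ-< a i<k

m+n≡1⇒n≡0 : ∀ {m n} → m ≢ 0 → m + n ≡ 1 → n ≡ 0
m+n≡1⇒n≡0 {zero}  m≢0 _  = ⊥-elim (m≢0 refl)
m+n≡1⇒n≡0 {suc m} _   eq = m+n≡0⇒n≡0 m (suc-injective eq)

m≤1+n∧m≢1+n⇒m≤n : ∀ {m n} → m ≤ suc n → m ≢ suc n → m ≤ n
m≤1+n∧m≢1+n⇒m≤n m≤1+n m≢1+n = s≤s⁻¹ (≤∧≢⇒< m≤1+n m≢1+n)

module _ {p} {P : Pred ℕ p} (P? : Decidable P) where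

  Least : ℕ → Set p
  Least n = P n × (∀ {j} → P j → n ≤ j)

  least : ∀ {k} → P k → Σ ℕ Least
  least {k} = <-rec (λ k → P k → Σ ℕ Least) step k
    where
    step : ∀ k → (∀ {j} → j < k → P j → Σ ℕ Least) → P k → Σ ℕ Least
    step k rec Pk with anyUpTo? P? k
    ... | yes (j , j<k , Pj) = rec j<k Pj
    ... | no ∄j = k , Pk , λ {j} Pj → ≮⇒≥ λ j<k → ∄j (j , j<k , Pj)

  largest : ∀ N {k} → k ≤ N → P k → Σ ℕ λ n → P n × n ≤ N × (∀ {j} → P j → j ≤ N → j ≤ n)
  largest N _ _ with P? N
  largest N       _       _  | yes PN = N , PN , ≤-refl , λ _ j≤N → j≤N
  largest zero    {k} k≤0 Pk | no ¬PN = ⊥-elim (¬PN (subst P (n≤0⇒n≡0 k≤0) Pk))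
  largest (suc N) {k} k≤ Pk  | no ¬PN
    with n , Pn , n≤N , max ← largest N (m≤1+n∧m≢1+n⇒m≤n k≤ λ { refl → ¬PN Pk }) Pk
    = n , Pn , m≤n⇒m≤1+n n≤N , λ Pj j≤ → max Pj (m≤1+n∧m≢1+n⇒m≤n j≤ λ { refl → ¬PN Pj })

concatᶠ : ∀ {A : Set} {n} → (Fin n → List A) → List A
concatᶠ {n = zero}  L = []
concatᶠ {n = suc n} L = L fzero ++ concatᶠ (L ∘ fsuc)

module _ {A : Set} where

  length-concatᶠ : ∀ {n} (L : Fin n → List A) → length (concatᶠ L) ≡ ∑[ i < n ] length (L i)
  length-concatᶠ {zero}  L = refl
  length-concatᶠ {suc n} L =
    trans (length-++ (L fzero)) (cong (length (L fzero) +_) (length-concatᶠ (L ∘ fsuc)))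

  ∈-concatᶠ⁺ : ∀ {n} (L : Fin n → List A) {x} i → x ∈ L i → x ∈ concatᶠ L
  ∈-concatᶠ⁺ {suc n} L fzero    x∈ = ∈-++⁺ˡ x∈
  ∈-concatᶠ⁺ {suc n} L (fsuc i) x∈ = ∈-++⁺ʳ (L fzero) (∈-concatᶠ⁺ (L ∘ fsuc) i x∈)

  ∈-concatᶠ⁻ : ∀ {n} (L : Fin n → List A) {x} → x ∈ concatᶠ L → ∃ λ i → x ∈ L i
  ∈-concatᶠ⁻ {suc n} L x∈ with ∈-++⁻ (L fzero) x∈
  ... | inj₁ x∈L₀ = fzero , x∈L₀
  ... | inj₂ x∈Lₛ with i , x∈Lᵢ ← ∈-concatᶠ⁻ (L ∘ fsuc) x∈Lₛ = fsuc i , x∈Lᵢ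

  concatᶠ-unique : ∀ {n} (L : Fin n → List A) → (∀ i → Unique (L i)) →
    (∀ {x} i j → x ∈ L i → x ∈ L j → i ≡ j) → Unique (concatᶠ L)
  concatᶠ-unique {zero}  L _  _        = []
  concatᶠ-unique {suc n} L uL disjoint = ++⁺ (uL fzero) uLₛ λ (x∈L₀ , x∈Lₛ) →
    let i , x∈Lᵢ = ∈-concatᶠ⁻ (L ∘ fsuc) x∈Lₛ in Finₚ.0≢1+n (disjoint fzero (fsuc i) x∈L₀ x∈Lᵢ)
    where
    uLₛ : Unique (concatᶠ (L ∘ fsuc))
    uLₛ = concatᶠ-unique (L ∘ fsuc) (uL ∘ fsuc)
            (λ i j x∈Lᵢ x∈Lⱼ → Finₚ.suc-injective (disjoint (fsuc i) (fsuc j) x∈Lᵢ x∈Lⱼ))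

∑-mono-≤ : ∀ {n} {f g : Fin n → ℕ} → (∀ i → f i ≤ g i) → sum f ≤ sum g
∑-mono-≤ {zero}  f≤g = z≤n
∑-mono-≤ {suc n} f≤g = +-mono-≤ (f≤g fzero) (∑-mono-≤ (f≤g ∘ fsuc))

≤-∑ : ∀ {n} (f : Fin n → ℕ) i → f i ≤ sum f
≤-∑ f fzero    = m≤m+n _ _
≤-∑ f (fsuc i) = ≤-trans (≤-∑ (f ∘ fsuc) i) (m≤n+m _ (f fzero))

∑-const : ∀ n k → ∑[ i < n ] k ≡ n * k
∑-const zero    k = refl
∑-const (suc n) k = cong (k +_) (∑-const n k)

∑-suc : ∀ {n} (f : Fin n → ℕ) → ∑[ i < n ] suc (f i) ≡ n + sum f
∑-suc {n} f = trans (∑-distrib-+ (λ _ → 1) f) (cong (_+ sum f) (trans (∑-const n 1) (*-identityʳ n)))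

module NumericalSemigroup (T : ℕ → Bool) (ns : IsNumericalSemigroup T) (has-gap : ∃ λ h → T h ≡ false) where

  open IsNumericalSemigroup ns
  open NSInv T

  1-gap : T 1 ≡ false
  1-gap = ¬-not λ T1 → not-¬ (everything T1 (proj₁ has-gap)) (proj₂ has-gap)
    where
    everything : T 1 ≡ true → ∀ y → T y ≡ true
    everything T1 zero    = has-zero
    everything T1 (suc y) = closed-add 1 y T1 (everything T1 y)

  private
    f : ℕ
    f = proj₁ cofinite

    gap<f : ∀ {h} → T h ≡ false → h < f
    gap<f {h} Th = ≰⇒> λ f≤h → not-¬ (proj₂ cofinite h f≤h) Th

  frobenius-spec : Σ ℕ λ F → T F ≡ false × (∀ {h} → T h ≡ false → h ≤ F)
  frobenius-spec
    with F , TF , _ , max ← largest (λ h → T h Bool.≟ false) f (<⇒≤ (gap<f (proj₂ has-gap))) (proj₂ has-gap)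
    = F , TF , λ Th → max Th (<⇒≤ (gap<f Th))

  F : ℕ
  F = proj₁ frobenius-spec

  F-gap : T F ≡ false
  F-gap = proj₁ (proj₂ frobenius-spec)

  gap⇒≤F : ∀ {h} → T h ≡ false → h ≤ F
  gap⇒≤F = proj₂ (proj₂ frobenius-spec)

  Gap⇒≤F : ∀ {h} → Gap h → h ≤ F
  Gap⇒≤F g = gap⇒≤F (¬-not g)

  F-Gap : Gap F
  F-Gap TF = not-¬ TF F-gap

  >F⇒∈ : ∀ {x} → F < x → T x ≡ true
  >F⇒∈ F<x = ¬-not λ Tx → <⇒≱ F<x (gap⇒≤F Tx)

  multiplicity-spec : Σ ℕ (Least (λ y → (0 <? y) ×-dec (T y Bool.≟ true)))
  multiplicity-spec = least (λ y → (0 <? y) ×-dec (T y Bool.≟ true)) {suc F} (s≤s z≤n , >F⇒∈ ≤-refl)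

  m : ℕ
  m = proj₁ multiplicity-spec

  m-∈ : T m ≡ true
  m-∈ = proj₂ (proj₁ (proj₂ multiplicity-spec))

  <m⇒gap : ∀ {y} → 0 < y → y < m → T y ≡ false
  <m⇒gap 0<y y<m = ¬-not λ Ty → <⇒≱ y<m (proj₂ (proj₂ multiplicity-spec) (0<y , Ty))

  2≤m : 2 ≤ m
  2≤m = ≤∧≢⇒< (proj₁ (proj₁ (proj₂ multiplicity-spec)))
          λ 1≡m → not-¬ (subst (λ y → T y ≡ true) (sym 1≡m) m-∈) 1-gap

  positives : List ℕ
  positives = filter (λ x → T x Bool.≟ true) (range 1 F)

  ∈-positives⁻ : ∀ {x} → x ∈ positives → (0 < x × x ≤ F) × T x ≡ true
  ∈-positives⁻ x∈ with x∈range , Tx ← ∈-filter⁻ (λ x → T x Bool.≟ true) x∈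
                  with 0<x , x<1+F ← ∈-range⁻ x∈range = (0<x , s≤s⁻¹ x<1+F) , Tx

  ∈-positives⁺ : ∀ {x} → 0 < x → x ≤ F → T x ≡ true → x ∈ positives
  ∈-positives⁺ 0<x x≤F = ∈-filter⁺ (λ x → T x Bool.≟ true) (∈-range⁺ 0<x (s≤s x≤F))

  positives-unique : Unique positives
  positives-unique = filter⁺ (λ x → T x Bool.≟ true) (range-unique 1 F)

  elements≤F : List ℕ
  elements≤F = 0 ∷ positives

  ∈-elements≤F⁺ : ∀ {x} → T x ≡ true → x ≤ F → x ∈ elements≤F
  ∈-elements≤F⁺ {zero}  _  _   = here refl
  ∈-elements≤F⁺ {suc x} Tx x≤F = there (∈-positives⁺ (s≤s z≤n) x≤F Tx)

  isN : IsN (suc (length positives))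
  isN = elements≤F , unique , (λ x → mk⇔ (to x) (from x)) , refl
    where
    unique : Unique elements≤F
    unique = All.tabulate (λ x∈ 0≡x → <⇒≢ (proj₁ (proj₁ (∈-positives⁻ x∈))) 0≡x) ∷ positives-unique
    to : ∀ x → x ∈ elements≤F → NSet x
    to x (here refl) = has-zero , F , F-Gap , z≤n
    to x (there x∈)  = proj₂ (∈-positives⁻ x∈) , F , F-Gap , proj₂ (proj₁ (∈-positives⁻ x∈))
    from : ∀ x → NSet x → x ∈ elements≤F
    from x (Tx , h , gap , x≤h) = ∈-elements≤F⁺ Tx (≤-trans x≤h (Gap⇒≤F gap))

  isC : IsC (suc F)
  isC = upTo (suc F) , upTo⁺ (suc F) , (λ x → mk⇔ (to x) (from x)) , length-upTo (suc F)
    where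
    to : ∀ x → x ∈ upTo (suc F) → CSet x
    to x x∈ = F , F-Gap , s≤s⁻¹ (∈-upTo⁻ x∈)
    from : ∀ x → CSet x → x ∈ upTo (suc F)
    from x (h , gap , x≤h) = ∈-upTo⁺ (s≤s (≤-trans x≤h (Gap⇒≤F gap)))

  Decomposable : ℕ → Set
  Decomposable x = Σ ℕ λ y → Σ ℕ λ z → InNS T y × InNS T z × y ≢ 0 × z ≢ 0 × x ≡ y + z

  decomposable? : ∀ x → Dec (Decomposable x)
  decomposable? x = map′ to from (anyUpTo? (λ y → (T y Bool.≟ true) ×-dec ¬? (y ≟ 0) ×-dec
                                                  (T (x ∸ y) Bool.≟ true) ×-dec ¬? (x ∸ y ≟ 0)) x)
    where
    Splitting : ℕ → Set
    Splitting y = y < x × T y ≡ true × y ≢ 0 × T (x ∸ y) ≡ true × x ∸ y ≢ 0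
    to : ∃ Splitting → Decomposable x
    to (y , y<x , Ty , y≢0 , Tz , z≢0) = y , x ∸ y , Ty , Tz , y≢0 , z≢0 , sym (m+[n∸m]≡n (<⇒≤ y<x))
    from : Decomposable x → ∃ Splitting
    from (y , z , Ty , Tz , y≢0 , z≢0 , refl) =
      y , m<m+n y (n≢0⇒n>0 z≢0) , Ty , y≢0 ,
      subst (λ z → T z ≡ true) (sym (m+n∸m≡n y z)) Tz , subst (_≢ 0) (sym (m+n∸m≡n y z)) z≢0

  MinGen? : ∀ x → Dec (MinGen x)
  MinGen? x = (T x Bool.≟ true) ×-dec ¬? (x ≟ 0) ×-dec ¬? (decomposable? x)

  -- Beyond F + m, x = m + (x − m) is a decomposition since x − m > F.
  MinGen⇒≤F+m : ∀ {x} → MinGen x → x ≤ F + m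
  MinGen⇒≤F+m {x} (_ , _ , indecomposable) = ≮⇒≥ λ F+m<x →
    indecomposable (m , x ∸ m , m-∈ , >F⇒∈ (F<x∸m F+m<x) , m≢0 , ≢-sym (<⇒≢ (≤-<-trans z≤n (F<x∸m F+m<x))) ,
                    sym (m+[n∸m]≡n (≤-trans (m≤n+m m F) (<⇒≤ F+m<x))))
    where
    m≢0 : m ≢ 0
    m≢0 m≡0 = <⇒≱ 2≤m (subst (_≤ 1) (sym m≡0) z≤n)
    F<x∸m : F + m < x → F < x ∸ m
    F<x∸m F+m<x = subst (_< x ∸ m) (m+n∸n≡m F m) (∸-monoˡ-< F+m<x (m≤n+m m F))

  minGenerators : List ℕ
  minGenerators = filter MinGen? (upTo (suc (F + m)))

  ∈-minGenerators⁻ : ∀ {x} → x ∈ minGenerators → MinGen x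
  ∈-minGenerators⁻ = proj₂ ∘ ∈-filter⁻ MinGen?

  minGenerators-unique : Unique minGenerators
  minGenerators-unique = filter⁺ MinGen? (upTo⁺ (suc (F + m)))

  isE : IsE (length minGenerators)
  isE = minGenerators , minGenerators-unique ,
        (λ x → mk⇔ ∈-minGenerators⁻ (λ g → ∈-filter⁺ MinGen? (∈-upTo⁺ (s≤s (MinGen⇒≤F+m g))) g)) , refl

  wilf : WilfNS T → suc F ≤ length minGenerators * suc (length positives)
  wilf w = w _ _ _ isE isN isC

  -- Every x ≤ F lies in [b, b + m) for the largest element b ≤ x of the semigroup.
  1+F≤n*m : suc F ≤ suc (length positives) * m
  1+F≤n*m = begin
    suc F                                           ≡⟨ length-upTo (suc F) ⟨
    length (upTo (suc F))                           ≤⟨ Unique⇒length≤ (upTo⁺ (suc F)) (covered ∘ s≤s⁻¹ ∘ ∈-upTo⁻) ⟩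
    length (concatMap (λ b → range b m) elements≤F) ≡⟨ length-concatMap-const (λ b → range b m)
                                                         (λ b → length-range b m) elements≤F ⟩
    suc (length positives) * m                      ∎
    where
    open ≤-Reasoning
    covered : ∀ {x} → x ≤ F → x ∈ concatMap (λ b → range b m) elements≤F
    covered {x} x≤F with b , Tb , b≤x , max ← largest (λ y → T y Bool.≟ true) x z≤n has-zero =
      ∈-concat⁺′ (∈-range⁺ b≤x x<b+m) (∈-map⁺ (λ b → range b m) (∈-elements≤F⁺ Tb (≤-trans b≤x x≤F)))
      where
      x<b+m : x < b + m
      x<b+m = ≰⇒> λ b+m≤x → <⇒≱ (m<m+n b (≤-trans (s≤s z≤n) 2≤m)) (max (closed-add b m Tb m-∈) b+m≤x)

pointwise-lookup : ∀ {A B : Set} {R : A → B → Set} {n} {x : Vec A n} {y : Vec B n} →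
  (∀ k → R (lookup x k) (lookup y k)) → Pointwise R x y
pointwise-lookup {x = []}    {[]}    _        = []
pointwise-lookup {x = _ ∷ _} {_ ∷ _} R-lookup = R-lookup fzero ∷ pointwise-lookup (R-lookup ∘ fsuc)

lookup-injective : ∀ {n} {x y : Vℕ n} → (∀ k → lookup x k ≡ lookup y k) → x ≡ y
lookup-injective = Pointwise-≡⇒≡ ∘ pointwise-lookup

lookup-⊕ : ∀ {n} (x y : Vℕ n) k → lookup (x ⊕ y) k ≡ lookup x k + lookup y k
lookup-⊕ x y k = lookup-zipWith _+_ k x y

lookup-≡⊕ : ∀ {n} {x y z : Vℕ n} → x ≡ y ⊕ z → ∀ k → lookup x k ≡ lookup y k + lookup z k
lookup-≡⊕ {y = y} {z} refl k = lookup-⊕ y z k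

lookup-𝟎 : ∀ {n} k → lookup (𝟎 n) k ≡ 0
lookup-𝟎 k = lookup-replicate k 0

module _ {d : ℕ} where

  lookup-scaledUnit-≡ : ∀ i a → lookup (scaledUnit d i a) i ≡ a
  lookup-scaledUnit-≡ i a = lookup∘update i (𝟎 d) a

  lookup-scaledUnit-≢ : ∀ {i k} a → k ≢ i → lookup (scaledUnit d i a) k ≡ 0
  lookup-scaledUnit-≢ {k = k} a k≢i = trans (lookup∘update′ k≢i (𝟎 d) a) (lookup-𝟎 k)

  lookup-scaledUnit≢0⇒≡ : ∀ {i k} a → lookup (scaledUnit d i a) k ≢ 0 → k ≡ i
  lookup-scaledUnit≢0⇒≡ {i} {k} a ≢0 with k Fin.≟ i
  ... | yes k≡i = k≡i
  ... | no  k≢i = ⊥-elim (≢0 (lookup-scaledUnit-≢ a k≢i))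

  scaledUnit-0 : ∀ i → scaledUnit d i 0 ≡ 𝟎 d
  scaledUnit-0 i = lookup-injective λ k → trans (value k) (sym (lookup-𝟎 k))
    where
    value : ∀ k → lookup (scaledUnit d i 0) k ≡ 0
    value k with k Fin.≟ i
    ... | yes refl = lookup-scaledUnit-≡ i 0
    ... | no  k≢i  = lookup-scaledUnit-≢ 0 k≢i

  scaledUnit-≢𝟎 : ∀ {i a} → a ≢ 0 → scaledUnit d i a ≢ 𝟎 d
  scaledUnit-≢𝟎 {i} {a} a≢0 eq =
    a≢0 (trans (sym (lookup-scaledUnit-≡ i a)) (trans (cong (λ v → lookup v i) eq) (lookup-𝟎 i)))

  scaledUnit-injective : ∀ {i a b} → scaledUnit d i a ≡ scaledUnit d i b → a ≡ b
  scaledUnit-injective {i} {a} {b} eq =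
    trans (sym (lookup-scaledUnit-≡ i a)) (trans (cong (λ v → lookup v i) eq) (lookup-scaledUnit-≡ i b))

  scaledUnit-≡⇒index-≡ : ∀ {i j a b} → a ≢ 0 → scaledUnit d i a ≡ scaledUnit d j b → i ≡ j
  scaledUnit-≡⇒index-≡ {i} {j} {a} {b} a≢0 eq = lookup-scaledUnit≢0⇒≡ b λ bᵢ≡0 →
    a≢0 (trans (sym (lookup-scaledUnit-≡ i a)) (trans (cong (λ v → lookup v i) eq) bᵢ≡0))

  scaledUnit-mono : ∀ i {a b} → a ≤ b → scaledUnit d i a ≤ᵥ scaledUnit d i b
  scaledUnit-mono i {a} {b} a≤b = pointwise-lookup compare
    where
    compare : ∀ k → lookup (scaledUnit d i a) k ≤ lookup (scaledUnit d i b) k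
    compare k with k Fin.≟ i
    ... | yes refl = subst₂ _≤_ (sym (lookup-scaledUnit-≡ i a)) (sym (lookup-scaledUnit-≡ i b)) a≤b
    ... | no  k≢i  = subst (_≤ _) (sym (lookup-scaledUnit-≢ a k≢i)) z≤n

  supported-on⇒scaledUnit : ∀ {y : Vℕ d} i → (∀ k → k ≢ i → lookup y k ≡ 0) → y ≡ scaledUnit d i (lookup y i)
  supported-on⇒scaledUnit {y} i off-i = lookup-injective value
    where
    value : ∀ k → lookup y k ≡ lookup (scaledUnit d i (lookup y i)) k
    value k with k Fin.≟ i
    ... | yes refl = sym (lookup-scaledUnit-≡ i _)
    ... | no  k≢i  = trans (off-i k k≢i) (sym (lookup-scaledUnit-≢ _ k≢i))

  supported-summand : ∀ {x y z : Vℕ d} i → (∀ k → lookup x k ≡ lookup y k + lookup z k) →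
    (∀ k → k ≢ i → lookup x k ≡ 0) → y ≡ scaledUnit d i (lookup y i)
  supported-summand i split x-off-i =
    supported-on⇒scaledUnit i λ k k≢i → m+n≡0⇒m≡0 _ (trans (sym (split k)) (x-off-i k k≢i))

  scaledUnit-coordinate-≢0 : ∀ {y : Vℕ d} {i} → y ≡ scaledUnit d i (lookup y i) → y ≢ 𝟎 d → lookup y i ≢ 0
  scaledUnit-coordinate-≢0 {i = i} y≡ y≢𝟎 yᵢ≡0 = y≢𝟎 (trans y≡ (trans (cong (scaledUnit d i) yᵢ≡0) (scaledUnit-0 i)))

local-bound : ∀ d' {F e b p n} → suc F ≤ e * suc b → suc F ≤ suc b * (2 + p) → suc b ≤ n →
  suc d' * suc F ≤ e * n + d' * (2 * suc b + p * n)
local-bound d' {F} {e} {b} {p} {n} wilf c≤nm n-bound = begin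
  suc d' * suc F                           ≡⟨⟩
  suc F + d' * suc F                       ≤⟨ +-mono-≤ wilf (*-monoʳ-≤ d' c≤nm) ⟩
  e * suc b + d' * (suc b * (2 + p))       ≡⟨ cong (λ t → e * suc b + d' * t) (expand b p) ⟩
  e * suc b + d' * (2 * suc b + suc b * p) ≤⟨ +-mono-≤ (*-monoʳ-≤ e n-bound)
                                                (*-monoʳ-≤ d' (+-monoʳ-≤ (2 * suc b) (*-monoˡ-≤ p n-bound))) ⟩
  e * n + d' * (2 * suc b + n * p)         ≡⟨ cong (λ t → e * n + d' * (2 * suc b + t)) (*-comm n p) ⟩
  e * n + d' * (2 * suc b + p * n)         ∎
  where
  open ≤-Reasoning
  expand : ∀ b p → suc b * (2 + p) ≡ 2 * suc b + suc b * p
  expand = solve-∀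

doubling-bound : ∀ d' s → d' * (2 * (suc d' + s)) ≤ d' * (suc d' * suc s + suc d')
doubling-bound zero    s = z≤n
doubling-bound (suc k) s = *-monoʳ-≤ (suc k) (begin
  2 * (2 + k + s)           ≡⟨ lhs k s ⟩
  (4 + 2 * k) + 2 * s       ≤⟨ +-monoʳ-≤ (4 + 2 * k) (*-monoˡ-≤ s (m≤m+n 2 k)) ⟩
  (4 + 2 * k) + (2 + k) * s ≡⟨ rhs k s ⟩
  (2 + k) * suc s + (2 + k) ∎)
  where
  open ≤-Reasoning
  lhs : ∀ k s → 2 * (2 + k + s) ≡ (4 + 2 * k) + 2 * s
  lhs = solve-∀
  rhs : ∀ k s → (4 + 2 * k) + (2 + k) * s ≡ (2 + k) * suc s + (2 + k)
  rhs = solve-∀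

-- F i, 1 + b i, e i and 2 + p i stand for the Frobenius number, n, e and the multiplicity
-- of the i-th factor, shifted so that no subtraction is needed.
glued-wilf-arithmetic : ∀ d' (F b e p : Fin (suc d') → ℕ) {c n E} →
  (∀ i → suc (F i) ≤ e i * suc (b i)) → (∀ i → suc (F i) ≤ suc (b i) * (2 + p i)) →
  c ≤ suc (sum F) → suc (sum b) ≤ n → sum e + d' * ∑[ i < suc d' ] suc (p i) ≤ E →
  suc d' * c ≤ E * n
glued-wilf-arithmetic d' F b e p {c} {n} {E} wilf c≤nm c-bound n-bound e-bound =
  +-cancelʳ-≤ (d' * D) (D * c) (E * n) (begin
    D * c + d' * D                                        ≤⟨ +-monoˡ-≤ (d' * D) (*-monoʳ-≤ D c-bound) ⟩
    D * suc (sum F) + d' * D                              ≡⟨ shift d' (sum F) ⟩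
    D * (D + sum F)                                       ≡⟨ summed-lhs ⟨
    ∑[ i < D ] (D * suc (F i))                            ≤⟨ ∑-mono-≤ local-bounds ⟩
    ∑[ i < D ] (e i * n + d' * (2 * suc (b i) + p i * n)) ≡⟨ summed-rhs ⟩
    sum e * n + d' * (2 * (D + sum b) + sum p * n)        ≡⟨ regroup d' (sum e) n (sum b) (sum p) ⟩
    sum e * n + d' * sum p * n + d' * (2 * (D + sum b))   ≤⟨ +-monoʳ-≤ (sum e * n + d' * sum p * n) doubled ⟩
    sum e * n + d' * sum p * n + d' * (D * n + D)         ≡⟨ collect d' (sum e) n (sum p) ⟩
    (sum e + d' * (D + sum p)) * n + d' * D               ≡⟨ cong (λ t → (sum e + d' * t) * n + d' * D) (∑-suc p) ⟨
    (sum e + d' * ∑[ i < D ] suc (p i)) * n + d' * D      ≤⟨ +-monoˡ-≤ (d' * D) (*-monoˡ-≤ n e-bound) ⟩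
    E * n + d' * D                                        ∎)
  where
  open ≤-Reasoning
  D : ℕ
  D = suc d'
  local-bounds : ∀ i → D * suc (F i) ≤ e i * n + d' * (2 * suc (b i) + p i * n)
  local-bounds i = local-bound d' {e = e i} (wilf i) (c≤nm i) (≤-trans (s≤s (≤-∑ b i)) n-bound)
  doubled : d' * (2 * (D + sum b)) ≤ d' * (D * n + D)
  doubled = ≤-trans (doubling-bound d' (sum b)) (*-monoʳ-≤ d' (+-monoˡ-≤ D (*-monoʳ-≤ D n-bound)))
  shift : ∀ d' s → suc d' * suc s + d' * suc d' ≡ suc d' * (suc d' + s)
  shift = solve-∀
  regroup : ∀ d' se n sb sp →
    se * n + d' * (2 * (suc d' + sb) + sp * n) ≡ se * n + d' * sp * n + d' * (2 * (suc d' + sb))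
  regroup = solve-∀
  collect : ∀ d' se n sp →
    se * n + d' * sp * n + d' * (suc d' * n + suc d') ≡ (se + d' * (suc d' + sp)) * n + d' * suc d'
  collect = solve-∀
  summed-lhs : ∑[ i < D ] (D * suc (F i)) ≡ D * (D + sum F)
  summed-lhs = trans (sym (*-distribˡ-sum D (λ i → suc (F i)))) (cong (D *_) (∑-suc F))
  summed-rhs : ∑[ i < D ] (e i * n + d' * (2 * suc (b i) + p i * n)) ≡ sum e * n + d' * (2 * (D + sum b) + sum p * n)
  summed-rhs = begin-equality
    ∑[ i < D ] (e i * n + d' * (2 * suc (b i) + p i * n))
      ≡⟨ ∑-distrib-+ (λ i → e i * n) (λ i → d' * (2 * suc (b i) + p i * n)) ⟩
    ∑[ i < D ] (e i * n) + ∑[ i < D ] (d' * (2 * suc (b i) + p i * n))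
      ≡⟨ cong₂ _+_ (sym (*-distribʳ-sum n e)) (sym (*-distribˡ-sum d' (λ i → 2 * suc (b i) + p i * n))) ⟩
    sum e * n + d' * ∑[ i < D ] (2 * suc (b i) + p i * n)
      ≡⟨ cong (λ t → sum e * n + d' * t) (∑-distrib-+ (λ i → 2 * suc (b i)) (λ i → p i * n)) ⟩
    sum e * n + d' * (∑[ i < D ] (2 * suc (b i)) + ∑[ i < D ] (p i * n))
      ≡⟨ cong (λ t → sum e * n + d' * t) (cong₂ _+_ twice-∑-suc (sym (*-distribʳ-sum n p))) ⟩
    sum e * n + d' * (2 * (D + sum b) + sum p * n)
      ∎
    where
    twice-∑-suc : ∑[ i < D ] (2 * suc (b i)) ≡ 2 * (D + sum b)
    twice-∑-suc = trans (sym (*-distribˡ-sum 2 (λ i → suc (b i)))) (cong (2 *_) (∑-suc b))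

module Glued (d' : ℕ) (T : Fin (suc d') → ℕ → Bool) (ns : ∀ i → IsNumericalSemigroup (T i))
             (has-gap : ∀ i → ∃ λ h → T i h ≡ false) where

  d : ℕ
  d = suc d'

  module Sᵢ (i : Fin d) = NumericalSemigroup (T i) (ns i) (has-gap i)
  open GNSInv d (GluedS d T)
  open import Data.List.Membership.DecPropositional (≡-dec {n = d} _≟_) using (_∈?_)

  S : Vℕ d → Set
  S = GluedS d T

  axis : Fin d → ℕ → Vℕ d
  axis = scaledUnit d

  axis-∈⇒∈ : ∀ {i a} → S (axis i a) → T i a ≡ true
  axis-∈⇒∈ {i} {a} ∈S = ¬-not λ Tia → ∈S (i , a , Tia , refl)

  ∈⇒axis-∈ : ∀ {i a} → T i a ≡ true → S (axis i a)
  ∈⇒axis-∈ {i} {a} Tia (j , h , Tjh , eq) with j Fin.≟ i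
  ... | yes refl = not-¬ Tia (subst (λ b → T i b ≡ false) (sym (scaledUnit-injective eq)) Tjh)
  ... | no  j≢i  = not-¬ (subst (λ b → T j b ≡ true) (sym h≡0) (IsNumericalSemigroup.has-zero (ns j))) Tjh
    where
    h≡0 : h ≡ 0
    h≡0 = trans (sym (lookup-scaledUnit-≡ j h)) (trans (cong (λ v → lookup v j) (sym eq)) (lookup-scaledUnit-≢ a j≢i))

  two-supports⇒∈ : ∀ {x : Vℕ d} {i j} → i ≢ j → lookup x i ≢ 0 → lookup x j ≢ 0 → S x
  two-supports⇒∈ {i = i} i≢j xᵢ≢0 xⱼ≢0 (k , h , _ , refl) with k Fin.≟ i
  ... | yes refl = xⱼ≢0 (lookup-scaledUnit-≢ h (≢-sym i≢j))
  ... | no  i≢k  = xᵢ≢0 (lookup-scaledUnit-≢ h (≢-sym i≢k))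

  𝟎-∈ : S (𝟎 d)
  𝟎-∈ = subst S (scaledUnit-0 fzero) (∈⇒axis-∈ (IsNumericalSemigroup.has-zero (ns fzero)))

  F-Gap : ∀ i → Gap (axis i (Sᵢ.F i))
  F-Gap i ∈S = ∈S (i , Sᵢ.F i , Sᵢ.F-gap i , refl)

  axisList : (Fin d → List ℕ) → List (Vℕ d)
  axisList K = concatᶠ (λ i → map (axis i) (K i))

  length-axisList : ∀ K → length (axisList K) ≡ ∑[ i < d ] length (K i)
  length-axisList K = trans (length-concatᶠ (λ i → map (axis i) (K i))) (sum-cong-≗ λ i → length-map (axis i) (K i))

  ∈-axisList⁺ : ∀ K i {a} → a ∈ K i → axis i a ∈ axisList K
  ∈-axisList⁺ K i a∈ = ∈-concatᶠ⁺ (λ i → map (axis i) (K i)) i (∈-map⁺ (axis i) a∈)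

  ∈-axisList⁻ : ∀ K {x} → x ∈ axisList K → Σ (Fin d) λ i → Σ ℕ λ a → a ∈ K i × x ≡ axis i a
  ∈-axisList⁻ K x∈ with ∈-concatᶠ⁻ (λ i → map (axis i) (K i)) x∈
  ... | i , x∈ᵢ with ∈-map⁻ (axis i) x∈ᵢ
  ... | a , a∈ , refl = i , a , a∈ , refl

  module _ (K : Fin d → List ℕ) (0∉K : ∀ i {a} → a ∈ K i → a ≢ 0) where

    axisList-unique : (∀ i → Unique (K i)) → Unique (axisList K)
    axisList-unique uK = concatᶠ-unique (λ i → map (axis i) (K i)) (λ i → map⁺ scaledUnit-injective (uK i)) disjoint
      where
      disjoint : ∀ {x} i j → x ∈ map (axis i) (K i) → x ∈ map (axis j) (K j) → i ≡ j
      disjoint i j x∈ᵢ x∈ⱼ with a , a∈ , refl ← ∈-map⁻ (axis i) x∈ᵢ | _ , _ , eq ← ∈-map⁻ (axis j) x∈ⱼ =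
        scaledUnit-≡⇒index-≡ (0∉K i a∈) eq

    𝟎∉axisList : All (𝟎 d ≢_) (axisList K)
    𝟎∉axisList = All.tabulate λ x∈ 𝟎≡x → case ∈-axisList⁻ K x∈ of λ (i , a , a∈ , x≡) →
      scaledUnit-≢𝟎 (0∉K i a∈) (trans (sym x≡) (sym 𝟎≡x))

  [1,F] : Fin d → List ℕ
  [1,F] i = range 1 (Sᵢ.F i)

  below-axis-gap : ∀ {x i b} → x ≤ᵥ axis i b → T i b ≡ false → x ∈ 𝟎 d ∷ axisList [1,F]
  below-axis-gap {x} {i} {b} x≤ Tib = subst (_∈ 𝟎 d ∷ axisList [1,F]) (sym x≡) (on-axis (lookup x i) xᵢ≤F)
    where
    x≡ : x ≡ axis i (lookup x i)
    x≡ = supported-on⇒scaledUnit i λ k k≢i →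
           n≤0⇒n≡0 (subst (lookup x k ≤_) (lookup-scaledUnit-≢ b k≢i) (Pointwise.lookup x≤ k))
    xᵢ≤F : lookup x i ≤ Sᵢ.F i
    xᵢ≤F = ≤-trans (subst (lookup x i ≤_) (lookup-scaledUnit-≡ i b) (Pointwise.lookup x≤ i)) (Sᵢ.gap⇒≤F i Tib)
    on-axis : ∀ a → a ≤ Sᵢ.F i → axis i a ∈ 𝟎 d ∷ axisList [1,F]
    on-axis zero    _   = here (scaledUnit-0 i)
    on-axis (suc a) a<F = there (∈-axisList⁺ [1,F] i (∈-range⁺ (s≤s z≤n) (s≤s a<F)))

  c-bound : ∀ {c} → IsC c → c ≤ suc (∑[ i < d ] Sᵢ.F i)
  c-bound {c} isC = subst (c ≤_) length-L (HasCard⇒≤length isC CSet⇒∈)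
    where
    L : List (Vℕ d)
    L = 𝟎 d ∷ axisList [1,F]
    -- A gap is given only negatively (¬ S h), which yields ¬ ¬ x ∈ L; membership in L is decidable.
    CSet⇒∈ : ∀ {x} → CSet x → x ∈ L
    CSet⇒∈ {x} (h , gap , x≤h) = decidable-stable (x ∈? L) λ x∉L →
      gap λ (i , b , Tib , h≡) → x∉L (below-axis-gap (subst (x ≤ᵥ_) h≡ x≤h) Tib)
    length-L : length L ≡ suc (∑[ i < d ] Sᵢ.F i)
    length-L = cong suc (trans (length-axisList [1,F]) (sum-cong-≗ λ i → length-range 1 (Sᵢ.F i)))

  n-bound : ∀ {n} → IsN n → suc (∑[ i < d ] length (Sᵢ.positives i)) ≤ n
  n-bound {n} isN = subst (_≤ n) (cong suc (length-axisList Sᵢ.positives)) (HasCard⇒length≤ isN unique ∈⇒NSet)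
    where
    0∉positives : ∀ i {a} → a ∈ Sᵢ.positives i → a ≢ 0
    0∉positives i a∈ = ≢-sym (<⇒≢ (proj₁ (proj₁ (Sᵢ.∈-positives⁻ i a∈))))
    unique : Unique (𝟎 d ∷ axisList Sᵢ.positives)
    unique = 𝟎∉axisList Sᵢ.positives 0∉positives ∷ axisList-unique Sᵢ.positives 0∉positives Sᵢ.positives-unique
    ∈⇒NSet : ∀ {x} → x ∈ 𝟎 d ∷ axisList Sᵢ.positives → NSet x
    ∈⇒NSet (here refl) =
      𝟎-∈ , axis fzero (Sᵢ.F fzero) , F-Gap fzero ,
      subst (_≤ᵥ axis fzero (Sᵢ.F fzero)) (scaledUnit-0 fzero) (scaledUnit-mono fzero z≤n)
    ∈⇒NSet (there x∈) with i , a , a∈ , refl ← ∈-axisList⁻ Sᵢ.positives x∈ =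
      ∈⇒axis-∈ (proj₂ (Sᵢ.∈-positives⁻ i a∈)) , axis i (Sᵢ.F i) , F-Gap i ,
      scaledUnit-mono i (proj₂ (proj₁ (Sᵢ.∈-positives⁻ i a∈)))

  axis-MinGen : ∀ i {g} → NSInv.MinGen (T i) g → MinGen (axis i g)
  axis-MinGen i {g} (Tg , g≢0 , indecomposable) = ∈⇒axis-∈ Tg , scaledUnit-≢𝟎 g≢0 , decomposition⇒⊥
    where
    decomposition⇒⊥ : ¬ (Σ (Vℕ d) λ y → Σ (Vℕ d) λ z → S y × S z × y ≢ 𝟎 d × z ≢ 𝟎 d × axis i g ≡ y ⊕ z)
    decomposition⇒⊥ (y , z , Sy , Sz , y≢𝟎 , z≢𝟎 , eq) =
      indecomposable (lookup y i , lookup z i , axis-∈⇒∈ (subst S y≡ Sy) , axis-∈⇒∈ (subst S z≡ Sz) ,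
                      scaledUnit-coordinate-≢0 y≡ y≢𝟎 , scaledUnit-coordinate-≢0 z≡ z≢𝟎 ,
                      trans (sym (lookup-scaledUnit-≡ i g)) (lookup-≡⊕ eq i))
      where
      off-i : ∀ k → k ≢ i → lookup (axis i g) k ≡ 0
      off-i k = lookup-scaledUnit-≢ g
      y≡ : y ≡ axis i (lookup y i)
      y≡ = supported-summand {x = axis i g} {z = z} i (lookup-≡⊕ eq) off-i
      z≡ : z ≡ axis i (lookup z i)
      z≡ = supported-summand {x = axis i g} {z = y} i (λ k → trans (lookup-≡⊕ eq k) (+-comm (lookup y k) _)) off-i

  mixed : Fin d → Fin d' → ℕ → Vℕ d
  mixed i j a = axis i a ⊕ axis (punchIn i j) 1

  lookup-mixed-i : ∀ i j a → lookup (mixed i j a) i ≡ a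
  lookup-mixed-i i j a = begin
    lookup (mixed i j a) i                                ≡⟨ lookup-⊕ (axis i a) _ i ⟩
    lookup (axis i a) i + lookup (axis (punchIn i j) 1) i ≡⟨ cong₂ _+_ (lookup-scaledUnit-≡ i a)
                                                               (lookup-scaledUnit-≢ 1 (≢-sym (punchInᵢ≢i i j))) ⟩
    a + 0                                                 ≡⟨ +-identityʳ a ⟩
    a                                                     ∎
    where open ≡-Reasoning

  lookup-mixed-j : ∀ i j a → lookup (mixed i j a) (punchIn i j) ≡ 1
  lookup-mixed-j i j a = trans (lookup-⊕ (axis i a) _ (punchIn i j))
    (cong₂ _+_ (lookup-scaledUnit-≢ a (punchInᵢ≢i i j)) (lookup-scaledUnit-≡ (punchIn i j) 1))

  lookup-mixed-off : ∀ {i j k} a → k ≢ i → k ≢ punchIn i j → lookup (mixed i j a) k ≡ 0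
  lookup-mixed-off {i} {j} {k} a k≢i k≢j = trans (lookup-⊕ (axis i a) _ k)
    (cong₂ _+_ (lookup-scaledUnit-≢ a k≢i) (lookup-scaledUnit-≢ 1 k≢j))

  lookup-mixed-≤1 : ∀ {i k} j a → k ≢ i → lookup (mixed i j a) k ≤ 1
  lookup-mixed-≤1 {i} {k} j a k≢i with k Fin.≟ punchIn i j
  ... | yes refl = ≤-reflexive (lookup-mixed-j i j a)
  ... | no  k≢j  = subst (_≤ 1) (sym (lookup-mixed-off a k≢i k≢j)) z≤n

  module _ (i : Fin d) (j : Fin d') {a : ℕ} (2≤a : 2 ≤ a) (a≤m : a ≤ Sᵢ.m i) where

    private
      jᵢ : Fin d
      jᵢ = punchIn i j

    -- Such a summand y lies on the i-th axis, at some b ≤ a. If b < a then b is a gap of Sᵢ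
    -- below its multiplicity; if b = a then the other summand is eⱼ, but 1 is a gap of Sⱼ.
    no-summand-off-j : ∀ {y z} → (∀ k → lookup (mixed i j a) k ≡ lookup y k + lookup z k) →
      S y → S z → y ≢ 𝟎 d → lookup y jᵢ ≡ 0 → ⊥
    no-summand-off-j {y} {z} split Sy Sz y≢𝟎 yⱼ≡0 with lookup z i ≟ 0
    ... | no zᵢ≢0 = not-¬ Tb (Sᵢ.<m⇒gap i (n≢0⇒n>0 (scaledUnit-coordinate-≢0 y≡ y≢𝟎)) (<-≤-trans b<a a≤m))
      where
      y-off-i : ∀ k → k ≢ i → lookup y k ≡ 0
      y-off-i k k≢i with k Fin.≟ jᵢ
      ... | yes refl = yⱼ≡0
      ... | no  k≢j  = m+n≡0⇒m≡0 _ (trans (sym (split k)) (lookup-mixed-off a k≢i k≢j))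
      y≡ : y ≡ axis i (lookup y i)
      y≡ = supported-on⇒scaledUnit i y-off-i
      Tb : T i (lookup y i) ≡ true
      Tb = axis-∈⇒∈ (subst S y≡ Sy)
      b<a : lookup y i < a
      b<a = subst (lookup y i <_) (trans (sym (split i)) (lookup-mixed-i i j a)) (m<m+n _ (n≢0⇒n>0 zᵢ≢0))
    ... | yes zᵢ≡0 = not-¬ (subst (λ c → T jᵢ c ≡ true) zⱼ≡1 (axis-∈⇒∈ (subst S z≡ Sz))) (Sᵢ.1-gap jᵢ)
      where
      z-off-j : ∀ k → k ≢ jᵢ → lookup z k ≡ 0
      z-off-j k k≢j with k Fin.≟ i
      ... | yes refl = zᵢ≡0
      ... | no  k≢i  = m+n≡0⇒n≡0 (lookup y k) (trans (sym (split k)) (lookup-mixed-off a k≢i k≢j))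
      z≡ : z ≡ axis jᵢ (lookup z jᵢ)
      z≡ = supported-on⇒scaledUnit jᵢ z-off-j
      zⱼ≡1 : lookup z jᵢ ≡ 1
      zⱼ≡1 = trans (sym (cong (_+ lookup z jᵢ) yⱼ≡0)) (trans (sym (split jᵢ)) (lookup-mixed-j i j a))

    mixed-MinGen : MinGen (mixed i j a)
    mixed-MinGen = two-supports⇒∈ (≢-sym (punchInᵢ≢i i j)) mixedᵢ≢0 mixedⱼ≢0 , mixed≢𝟎 , decomposition⇒⊥
      where
      mixedᵢ≢0 : lookup (mixed i j a) i ≢ 0
      mixedᵢ≢0 aᵢ≡0 = <⇒≢ (≤-trans (s≤s z≤n) 2≤a) (sym (trans (sym (lookup-mixed-i i j a)) aᵢ≡0))
      mixedⱼ≢0 : lookup (mixed i j a) jᵢ ≢ 0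
      mixedⱼ≢0 eq = 1+n≢0 (trans (sym (lookup-mixed-j i j a)) eq)
      mixed≢𝟎 : mixed i j a ≢ 𝟎 d
      mixed≢𝟎 eq = mixedⱼ≢0 (trans (cong (λ v → lookup v jᵢ) eq) (lookup-𝟎 jᵢ))
      decomposition⇒⊥ : ¬ (Σ (Vℕ d) λ y → Σ (Vℕ d) λ z → S y × S z × y ≢ 𝟎 d × z ≢ 𝟎 d × mixed i j a ≡ y ⊕ z)
      decomposition⇒⊥ (y , z , Sy , Sz , y≢𝟎 , z≢𝟎 , eq) with lookup y jᵢ ≟ 0
      ... | yes yⱼ≡0 = no-summand-off-j (lookup-≡⊕ eq) Sy Sz y≢𝟎 yⱼ≡0
      ... | no  yⱼ≢0 = no-summand-off-j (λ k → trans (lookup-≡⊕ eq k) (+-comm (lookup y k) _)) Sz Sy z≢𝟎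
                         (m+n≡1⇒n≡0 yⱼ≢0 (trans (sym (lookup-≡⊕ eq jᵢ)) (lookup-mixed-j i j a)))

  p : Fin d → ℕ
  p i = Sᵢ.m i ∸ 2

  m≡2+p : ∀ i → Sᵢ.m i ≡ 2 + p i
  m≡2+p i = sym (m+[n∸m]≡n (Sᵢ.2≤m i))

  mixedList : Fin d → Fin d' → List (Vℕ d)
  mixedList i j = map (mixed i j) (range 2 (suc (p i)))

  mixedGenerators : List (Vℕ d)
  mixedGenerators = concatᶠ λ i → concatᶠ (mixedList i)

  ∈-mixedList⁻ : ∀ {i j x} → x ∈ mixedList i j → Σ ℕ λ a → (2 ≤ a × a ≤ Sᵢ.m i) × x ≡ mixed i j a
  ∈-mixedList⁻ {i} {j} x∈ with a , a∈ , refl ← ∈-map⁻ (mixed i j) x∈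
                          with 2≤a , a<3+p ← ∈-range⁻ a∈ =
    a , (2≤a , subst (a ≤_) (sym (m≡2+p i)) (s≤s⁻¹ (subst (a <_) (+-suc 2 (p i)) a<3+p))) , refl

  ∈-mixedGenerators⁻ : ∀ {x} → x ∈ mixedGenerators →
    Σ (Fin d) λ i → Σ (Fin d') λ j → Σ ℕ λ a → (2 ≤ a × a ≤ Sᵢ.m i) × x ≡ mixed i j a
  ∈-mixedGenerators⁻ x∈ with ∈-concatᶠ⁻ (λ i → concatᶠ (mixedList i)) x∈
  ... | i , x∈ᵢ with ∈-concatᶠ⁻ (mixedList i) x∈ᵢ
  ... | j , x∈ᵢⱼ = i , j , ∈-mixedList⁻ x∈ᵢⱼ

  mixed-injectiveʳ : ∀ {i j a b} → mixed i j a ≡ mixed i j b → a ≡ b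
  mixed-injectiveʳ {i} {j} {a} {b} eq =
    trans (sym (lookup-mixed-i i j a)) (trans (cong (λ v → lookup v i) eq) (lookup-mixed-i i j b))

  -- Only at coordinate i does mixed i j a exceed 1.
  mixed-≡⇒≡ : ∀ {i i′ j j′ a b} → 2 ≤ a → mixed i j a ≡ mixed i′ j′ b → i ≡ i′ × j ≡ j′
  mixed-≡⇒≡ {i} {i′} {j} {j′} {a} {b} 2≤a eq with i Fin.≟ i′
  ... | no  i≢i′ = ⊥-elim (<⇒≱ 2≤a (subst (_≤ 1) (sym aᵢ) (lookup-mixed-≤1 j′ b i≢i′)))
    where
    aᵢ : a ≡ lookup (mixed i′ j′ b) i
    aᵢ = trans (sym (lookup-mixed-i i j a)) (cong (λ v → lookup v i) eq)
  ... | yes refl with punchIn i j Fin.≟ punchIn i j′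
  ...   | yes jᵢ≡j′ᵢ = refl , punchIn-injective i j j′ jᵢ≡j′ᵢ
  ...   | no  jᵢ≢j′ᵢ = ⊥-elim (1+n≢0 (trans (sym (lookup-mixed-j i j a))
                          (trans (cong (λ v → lookup v (punchIn i j)) eq)
                                 (lookup-mixed-off b (punchInᵢ≢i i j) jᵢ≢j′ᵢ))))

  mixedGenerators-unique : Unique mixedGenerators
  mixedGenerators-unique = concatᶠ-unique (λ i → concatᶠ (mixedList i)) unique-over-j disjointᵢ
    where
    disjointⱼ : ∀ i {x} j j′ → x ∈ mixedList i j → x ∈ mixedList i j′ → j ≡ j′
    disjointⱼ i j j′ x∈ x∈′ with a , (2≤a , _) , refl ← ∈-mixedList⁻ x∈ | _ , _ , eq ← ∈-mixedList⁻ x∈′ =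
      proj₂ (mixed-≡⇒≡ 2≤a eq)
    unique-over-j : ∀ i → Unique (concatᶠ (mixedList i))
    unique-over-j i =
      concatᶠ-unique (mixedList i) (λ j → map⁺ mixed-injectiveʳ (range-unique 2 (suc (p i)))) (disjointⱼ i)
    disjointᵢ : ∀ {x} i i′ → x ∈ concatᶠ (mixedList i) → x ∈ concatᶠ (mixedList i′) → i ≡ i′
    disjointᵢ i i′ x∈ x∈′
      with j , x∈ⱼ ← ∈-concatᶠ⁻ (mixedList i) x∈ | j′ , x∈′ⱼ ← ∈-concatᶠ⁻ (mixedList i′) x∈′
      with a , (2≤a , _) , refl ← ∈-mixedList⁻ x∈ⱼ | _ , _ , eq ← ∈-mixedList⁻ x∈′ⱼ = proj₁ (mixed-≡⇒≡ 2≤a eq)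

  length-mixedGenerators : length mixedGenerators ≡ d' * ∑[ i < d ] suc (p i)
  length-mixedGenerators = begin
    length mixedGenerators                        ≡⟨ length-concatᶠ (λ i → concatᶠ (mixedList i)) ⟩
    ∑[ i < d ] length (concatᶠ (mixedList i))     ≡⟨ sum-cong-≗ (λ i → length-concatᶠ (mixedList i)) ⟩
    ∑[ i < d ] ∑[ j < d' ] length (mixedList i j) ≡⟨ sum-cong-≗ (λ i → sum-cong-≗ λ j → length-mixedList i j) ⟩
    ∑[ i < d ] ∑[ j < d' ] suc (p i)              ≡⟨ sum-cong-≗ (λ i → ∑-const d' (suc (p i))) ⟩
    ∑[ i < d ] (d' * suc (p i))                   ≡⟨ *-distribˡ-sum d' (λ i → suc (p i)) ⟨
    d' * ∑[ i < d ] suc (p i)                     ∎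
    where
    open ≡-Reasoning
    length-mixedList : ∀ i j → length (mixedList i j) ≡ suc (p i)
    length-mixedList i j = trans (length-map (mixed i j) (range 2 (suc (p i)))) (length-range 2 (suc (p i)))

  -- Both nonzero coordinates of mixed i′ j a would have to be the single one of axis i g.
  axis≢mixed : ∀ i g i′ j {a} → 2 ≤ a → axis i g ≢ mixed i′ j a
  axis≢mixed i g i′ j {a} 2≤a eq =
    punchInᵢ≢i i′ j (trans (on-axis (punchIn i′ j) 1+n≢0 (lookup-mixed-j i′ j a))
                           (sym (on-axis i′ a≢0 (lookup-mixed-i i′ j a))))
    where
    a≢0 : a ≢ 0
    a≢0 = ≢-sym (<⇒≢ (≤-trans (s≤s z≤n) 2≤a))
    on-axis : ∀ k {c} → c ≢ 0 → lookup (mixed i′ j a) k ≡ c → k ≡ i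
    on-axis k c≢0 mixedₖ≡c = lookup-scaledUnit≢0⇒≡ g λ gₖ≡0 →
      c≢0 (trans (sym mixedₖ≡c) (trans (cong (λ v → lookup v k) (sym eq)) gₖ≡0))

  generators : List (Vℕ d)
  generators = axisList Sᵢ.minGenerators ++ mixedGenerators

  generators-unique : Unique generators
  generators-unique = ++⁺ axisGenerators-unique mixedGenerators-unique disjoint
    where
    axisGenerators-unique : Unique (axisList Sᵢ.minGenerators)
    axisGenerators-unique = axisList-unique Sᵢ.minGenerators (λ i g∈ → proj₁ (proj₂ (Sᵢ.∈-minGenerators⁻ i g∈)))
                              Sᵢ.minGenerators-unique
    disjoint : ∀ {x} → ¬ (x ∈ axisList Sᵢ.minGenerators × x ∈ mixedGenerators)
    disjoint (x∈axes , x∈mixed) =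
      let i , g , _ , x≡axis = ∈-axisList⁻ Sᵢ.minGenerators x∈axes
          i′ , j , a , (2≤a , _) , x≡mixed = ∈-mixedGenerators⁻ x∈mixed
      in axis≢mixed i g i′ j {a} 2≤a (trans (sym x≡axis) x≡mixed)

  ∈-generators⇒MinGen : ∀ {x} → x ∈ generators → MinGen x
  ∈-generators⇒MinGen x∈ with ∈-++⁻ (axisList Sᵢ.minGenerators) x∈
  ... | inj₁ x∈axes  = let i , g , g∈ , x≡ = ∈-axisList⁻ Sᵢ.minGenerators x∈axes in
                       subst MinGen (sym x≡) (axis-MinGen i (Sᵢ.∈-minGenerators⁻ i g∈))
  ... | inj₂ x∈mixed = let i , j , a , (2≤a , a≤m) , x≡ = ∈-mixedGenerators⁻ x∈mixed in
                       subst MinGen (sym x≡) (mixed-MinGen i j 2≤a a≤m)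

  length-generators : length generators ≡ ∑[ i < d ] length (Sᵢ.minGenerators i) + d' * ∑[ i < d ] suc (p i)
  length-generators =
    trans (length-++ (axisList Sᵢ.minGenerators)) (cong₂ _+_ (length-axisList Sᵢ.minGenerators) length-mixedGenerators)

  e-bound : ∀ {e} → IsE e → ∑[ i < d ] length (Sᵢ.minGenerators i) + d' * ∑[ i < d ] suc (p i) ≤ e
  e-bound {e} isE = subst (_≤ e) length-generators (HasCard⇒length≤ isE generators-unique ∈-generators⇒MinGen)

proposition5p5 : (d : ℕ) → 1 ≤ d → (T : Fin d → ℕ → Bool) →
    (∀ i → IsNumericalSemigroup (T i)) →
    (∀ i → ∃ λ h → T i h ≡ false) →
    (∀ i → WilfNS (T i)) →
    GenWilf d (GluedS d T)
proposition5p5 (suc d') _ T ns has-gap wilf e n c isE isN isC =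
  glued-wilf-arithmetic d' Sᵢ.F (λ i → length (Sᵢ.positives i)) (λ i → length (Sᵢ.minGenerators i)) p
    (λ i → Sᵢ.wilf i (wilf i))
    (λ i → subst (λ m → suc (Sᵢ.F i) ≤ suc (length (Sᵢ.positives i)) * m) (m≡2+p i) (Sᵢ.1+F≤n*m i))
    (c-bound isC) (n-bound isN) (e-bound isE)
  where open Glued d' T ns has-gap
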